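{- Let $G$ be a graph with possible loops and let $u,v$ be non-adjacent vertices of $G$ that both have loops. If there is an induced $(u,v)$-path in $G$ whose internal vertices do not all have loops, then $G$ contains, as an induced subgraph, a graph in $\mathcal F_9$. In particular, if there is a $(u,v)$-walk in $G$ all of whose internal vertices are without loops, then $G$ contains a graph in $\mathcal F_9$ as an induced subgraph.
   Context: A graph with possible loops is an undirected graph in which each vertex may or may not carry a loop. Induced subgraphs preserve loops. $\mathcal F_9$ is the family of paths $u_0u_1\dots u_m$ with $m\ge2$ (and no other edges) having loops exactly at the two end vertices $u_0,u_m$ and no loops at internal vertices. -}

module Defs where

open import Data.Nat using (ℕ; zero; suc; _+_; _≤_; _<_; _≡ᵇ_)
open import Data.Fin using (Fin; toℕ; fromℕ; inject₁) renaming (zero to fzero; suc to fsuc)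
open import Data.Bool using (Bool; true; false; _∨_; _∧_)
open import Data.Product using (Σ; _×_; ∃-syntax)
open import Relation.Binary.PropositionalEquality using (_≡_)
open import Relation.Nullary using (¬_)
open import Function.Definitions using (Injective)

record Graph (n : ℕ) : Set where
  field
    adj : Fin n → Fin n → Bool
    sym : ∀ x y → adj x y ≡ adj y x
open Graph public

Adj : ∀ {n} → Graph n → Fin n → Fin n → Set
Adj G x y = adj G x y ≡ true

HasLoop : ∀ {n} → Graph n → Fin n → Set
HasLoop G x = Adj G x x

-- Adjacency of the member of F₉ on vertices u₀ … u_m (as Fin (suc m)):
-- i ~ j iff |i - j| = 1, or i = j ∈ {0, m} (loops exactly at the ends).
f9adj : (m : ℕ) → Fin (suc m) → Fin (suc m) → Bool
f9adj m i j =
  ((toℕ i + 1) ≡ᵇ toℕ j) ∨ ((toℕ j + 1) ≡ᵇ toℕ i)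
  ∨ ((toℕ i ≡ᵇ toℕ j) ∧ ((toℕ i ≡ᵇ 0) ∨ (toℕ i ≡ᵇ m)))

-- G contains (a graph isomorphic to) a member of F₉ as an induced subgraph
-- (induced subgraphs preserve loops: the embedding condition includes i = j).
ContainsF9 : ∀ {n} → Graph n → Set
ContainsF9 {n} G =
  Σ ℕ λ m → (2 ≤ m) × Σ (Fin (suc m) → Fin n) λ f →
    Injective _≡_ _≡_ f × (∀ i j → adj G (f i) (f j) ≡ f9adj m i j)

record Walk {n} (G : Graph n) (u v : Fin n) : Set where
  field
    len   : ℕ
    vtx   : Fin (suc len) → Fin n
    start : vtx fzero ≡ u
    end   : vtx (fromℕ len) ≡ v
    step  : ∀ (i : Fin len) → Adj G (vtx (inject₁ i)) (vtx (fsuc i))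
open Walk public

Internal : ∀ {n} {G : Graph n} {u v} → (W : Walk G u v) → Fin (suc (len W)) → Set
Internal W i = (0 < toℕ i) × (toℕ i < len W)

record InducedPath {n} (G : Graph n) (u v : Fin n) : Set where
  field
    walk     : Walk G u v
    distinct : Injective _≡_ _≡_ (vtx walk)
    chordless : ∀ i j → ¬ (toℕ i ≡ toℕ j) → ¬ (toℕ i + 1 ≡ toℕ j) → ¬ (toℕ j + 1 ≡ toℕ i)
                → ¬ Adj G (vtx walk i) (vtx walk j)
open InducedPath public

module Submission where

-- A member of F₉ is exactly a chordless walk of length at least two whose ends carry
-- loops and whose interior vertices do not; such a walk is automatically injective,
-- since a repeated vertex would create a chord. On an induced (u,v)-path with a loopless
-- vertex, two looped vertices at distance at least two with no looped vertex between
-- them bound such a walk. A (u,v)-walk with loopless interior is shortened along chords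
-- until it is chordless, and it keeps length at least two because u and v are distinct
-- and non-adjacent.

open import Defs hiding (sym)
open import Data.Nat using (ℕ; zero; suc; _+_; _∸_; _≤_; _<_; _≡ᵇ_; z≤n; s≤s; s≤s⁻¹; z<s; _≟_; _≤?_; anyUpTo?)
open import Data.Nat.Properties
open import Data.Nat.Induction using (<-wellFounded)
open import Data.Fin using (Fin; toℕ; fromℕ<)
open import Data.Fin.Properties using (toℕ-injective; toℕ-fromℕ<; toℕ-inject₁; toℕ≤pred[n]; toℕ-fromℕ)
open import Data.Bool using (true; T)
open import Data.Bool.Properties using (T-≡; T-∨; T-∧; ⇔→≡) renaming (_≟_ to _≟ᵇ_)
open import Data.Empty using (⊥-elim)
open import Data.Product using (Σ; _×_; _,_; ∃; ∃-syntax)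
open import Data.Product.Function.NonDependent.Propositional using (_×-⇔_)
open import Data.Sum using (_⊎_; inj₁; inj₂)
open import Data.Sum.Function.Propositional using (_⊎-⇔_)
open import Function using (_∘_; _⇔_; mk⇔)
open import Function.Properties.Equivalence using () renaming (trans to ⇔-trans; sym to ⇔-sym)
open import Induction.WellFounded using (Acc; acc)
open import Relation.Binary.PropositionalEquality using (_≡_; _≢_; refl; sym; trans; cong; subst; subst₂)
open import Relation.Binary.Definitions using (tri<; tri≈; tri>)
open import Relation.Nullary using (¬_; Dec; yes; no)
open import Relation.Nullary.Decidable using (map′; _×-dec_)
open import Relation.Unary using (Pred; Decidable)

F9Edge : ℕ → ℕ → ℕ → Set
F9Edge m i j = suc i ≡ j ⊎ suc j ≡ i ⊎ (i ≡ j × (i ≡ 0 ⊎ i ≡ m))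

T-≡ᵇ : ∀ a b → T (a ≡ᵇ b) ⇔ a ≡ b
T-≡ᵇ a b = mk⇔ (≡ᵇ⇒≡ a b) (≡⇒≡ᵇ a b)

T-+1≡ᵇ : ∀ a b → T (a + 1 ≡ᵇ b) ⇔ suc a ≡ b
T-+1≡ᵇ a b = ⇔-trans (T-≡ᵇ (a + 1) b) (mk⇔ (trans (+-comm 1 a)) (trans (+-comm a 1)))

f9adj≡true⇔F9Edge : ∀ m (i j : Fin (suc m)) → f9adj m i j ≡ true ⇔ F9Edge m (toℕ i) (toℕ j)
f9adj≡true⇔F9Edge m i j =
  ⇔-trans (⇔-sym T-≡) (⇔-trans T-∨ (T-+1≡ᵇ a b ⊎-⇔ ⇔-trans T-∨ (T-+1≡ᵇ b a ⊎-⇔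
    ⇔-trans T-∧ (T-≡ᵇ a b ×-⇔ ⇔-trans T-∨ (T-≡ᵇ a 0 ⊎-⇔ T-≡ᵇ a m)))))
  where
  a b : ℕ
  a = toℕ i
  b = toℕ j

module _ {p} {P : Pred ℕ p} (P? : Decidable P) where

  last-before : P 0 → ∀ x → ¬ P x → ∃[ a ] a < x × P a × (∀ k → a < k → k ≤ x → ¬ P k)
  last-before p0 zero ¬p0 = ⊥-elim (¬p0 p0)
  last-before p0 (suc x) ¬p1+x with P? x
  ... | yes px = x , ≤-refl , px , λ k x<k k≤1+x → subst (¬_ ∘ P) (≤-antisym x<k k≤1+x) ¬p1+x
  ... | no ¬px with last-before p0 x ¬px
  ...   | a , a<x , pa , after = a , m<n⇒m<1+n a<x , pa , after′
    where
    after′ : ∀ k → a < k → k ≤ suc x → ¬ P k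
    after′ k a<k k≤1+x with m≤n⇒m<n∨m≡n k≤1+x
    ... | inj₁ k<1+x = after k a<k (s≤s⁻¹ k<1+x)
    ... | inj₂ refl  = ¬p1+x

  Gap : ℕ → Set p
  Gap L = ∃[ a ] ∃[ b ] 2 + a ≤ b × b ≤ L × P a × P b × (∀ k → a < k → k < b → ¬ P k)

  gap : P 0 → ∀ L → P L → ∀ x → x ≤ L → ¬ P x → Gap L
  gap p0 zero _ _ z≤n ¬p0 = ⊥-elim (¬p0 p0)
  gap p0 (suc L) p1+L x x≤1+L ¬px with P? L
  ... | yes pL with gap p0 L pL x (s≤s⁻¹ (≤∧≢⇒< x≤1+L λ { refl → ¬px p1+L })) ¬px
  ...   | a , b , wide , b≤L , pa , pb , between = a , b , wide , m≤n⇒m≤1+n b≤L , pa , pb , between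
  gap p0 (suc L) p1+L x x≤1+L ¬px | no ¬pL with last-before p0 L ¬pL
  ...   | a , a<L , pa , after =
    a , suc L , s≤s a<L , ≤-refl , pa , p1+L , λ k a<k k<1+L → after k a<k (s≤s⁻¹ k<1+L)

skip : ℕ → ℕ → ℕ → ℕ
skip i d k with k ≤? i
... | yes _ = k
... | no  _ = k + d

skip-≤ : ∀ {i k} d → k ≤ i → skip i d k ≡ k
skip-≤ {i} {k} d k≤i with k ≤? i
... | yes _   = refl
... | no  k≰i = ⊥-elim (k≰i k≤i)

skip-> : ∀ {i k} d → i < k → skip i d k ≡ k + d
skip-> {i} {k} d i<k with k ≤? i
... | yes k≤i = ⊥-elim (<⇒≱ i<k k≤i)
... | no  _   = refl

clamp : ∀ L → ℕ → Fin (suc L)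
clamp L k = fromℕ< (s≤s (m⊓n≤n k L))

toℕ-clamp : ∀ {L k} → k ≤ L → toℕ (clamp L k) ≡ k
toℕ-clamp k≤L = trans (toℕ-fromℕ< _) (m≤n⇒m⊓n≡m k≤L)

clamp-toℕ : ∀ {L k} (x : Fin (suc L)) → toℕ x ≡ k → clamp L k ≡ x
clamp-toℕ x refl = toℕ-injective (toℕ-clamp (toℕ≤pred[n] x))

far-apart : ∀ {i j} → 2 + i ≤ j → i ≢ j × i + 1 ≢ j × j + 1 ≢ i
far-apart {i} {j} far =
  <⇒≢ i<j ,
  (λ i+1≡j → <⇒≢ far (trans (+-comm 1 i) i+1≡j)) ,
  (λ j+1≡i → <⇒≢ (<-trans i<j (m<m+n j z<s)) (sym j+1≡i))
  where
  i<j : i < j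
  i<j = ≤-trans (n≤1+n _) far

module _ {n} (G : Graph n) where

  NoLoop : Fin n → Set
  NoLoop x = ¬ HasLoop G x

  Adj-sym : ∀ {x y} → Adj G x y → Adj G y x
  Adj-sym {x} {y} xy = trans (Graph.sym G y x) xy

  -- Indexing by ℕ rather than Fin makes segments and splices easy to form;
  -- `at` beyond `size` is junk.
  record ℕWalk (u v : Fin n) : Set where
    field
      size    : ℕ
      at      : ℕ → Fin n
      at-0    : at 0 ≡ u
      at-size : at size ≡ v
      edge    : ∀ i → i < size → Adj G (at i) (at (suc i))
  open ℕWalk

  module _ {u v : Fin n} (W : ℕWalk u v) where

    Chordless : Set
    Chordless = ∀ i j → j ≤ size W → 2 + i ≤ j → ¬ Adj G (at W i) (at W j)

    AllInterior : (Fin n → Set) → Set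
    AllInterior P = ∀ i → 0 < i → i < size W → P (at W i)

  loop-at-0 : ∀ {u v} (W : ℕWalk u v) → HasLoop G u → HasLoop G (at W 0)
  loop-at-0 W = subst (HasLoop G) (sym (at-0 W))

  loop-at-size : ∀ {u v} (W : ℕWalk u v) → HasLoop G v → HasLoop G (at W (size W))
  loop-at-size W = subst (HasLoop G) (sym (at-size W))

  module LoopedEnds {u v : Fin n} (W : ℕWalk u v) (loop-u : HasLoop G u) (loop-v : HasLoop G v)
                    (chordless : Chordless W) (loopless : AllInterior W NoLoop) where

    private
      m : ℕ
      m = size W

    loop-0 : HasLoop G (at W 0)
    loop-0 = loop-at-0 W loop-u

    loop-m : HasLoop G (at W m)
    loop-m = loop-at-size W loop-v

    F9Edge⇒Adj : ∀ {i j} → i ≤ m → j ≤ m → F9Edge m i j → Adj G (at W i) (at W j)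
    F9Edge⇒Adj _   j≤m (inj₁ refl)                    = edge W _ j≤m
    F9Edge⇒Adj i≤m _   (inj₂ (inj₁ refl))             = Adj-sym (edge W _ i≤m)
    F9Edge⇒Adj _   _   (inj₂ (inj₂ (refl , inj₁ refl))) = loop-0
    F9Edge⇒Adj _   _   (inj₂ (inj₂ (refl , inj₂ refl))) = loop-m

    Adj⇒F9Edge : ∀ {i j} → i ≤ m → j ≤ m → Adj G (at W i) (at W j) → F9Edge m i j
    Adj⇒F9Edge {i} {j} i≤m j≤m ij with <-cmp i j
    ... | tri< i<j _ _ with suc i ≟ j
    ...   | yes 1+i≡j = inj₁ 1+i≡j
    ...   | no  1+i≢j = ⊥-elim (chordless i j j≤m (≤∧≢⇒< i<j 1+i≢j) ij)
    Adj⇒F9Edge {i} {j} i≤m j≤m ij | tri> _ _ j<i with suc j ≟ i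
    ...   | yes 1+j≡i = inj₂ (inj₁ 1+j≡i)
    ...   | no  1+j≢i = ⊥-elim (chordless j i i≤m (≤∧≢⇒< j<i 1+j≢i) (Adj-sym ij))
    Adj⇒F9Edge {i} i≤m _ ii | tri≈ _ refl _ with i ≟ 0 | i ≟ m
    ... | yes i≡0 | _       = inj₂ (inj₂ (refl , inj₁ i≡0))
    ... | no  _   | yes i≡m = inj₂ (inj₂ (refl , inj₂ i≡m))
    ... | no  i≢0 | no  i≢m = ⊥-elim (loopless i (n≢0⇒n>0 i≢0) (≤∧≢⇒< i≤m i≢m) ii)

    -- A repeated vertex at i < j yields a chord: through the predecessor of i, the
    -- successor of j, or, when i = 0 and j = m, through the loop at the common vertex.
    at-distinct : 2 ≤ m → ∀ {i j} → i < j → j ≤ m → at W i ≢ at W j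
    at-distinct _ {suc i} i<j j≤m eq =
      chordless i _ j≤m i<j (subst (Adj G (at W i)) eq (edge W i (≤-trans (n≤1+n _) (≤-trans i<j j≤m))))
    at-distinct 2≤m {zero} {j} 0<j j≤m eq with m≤n⇒m<n∨m≡n j≤m
    ... | inj₁ j<m  =
      chordless 0 (suc j) j<m (s≤s 0<j) (subst (λ x → Adj G x (at W (suc j))) (sym eq) (edge W j j<m))
    ... | inj₂ refl = chordless 0 j ≤-refl 2≤m (subst (Adj G (at W 0)) eq loop-0)

    at-injective : 2 ≤ m → ∀ {i j} → i ≤ m → j ≤ m → at W i ≡ at W j → i ≡ j
    at-injective 2≤m {i} {j} i≤m j≤m eq with <-cmp i j
    ... | tri< i<j _ _ = ⊥-elim (at-distinct 2≤m i<j j≤m eq)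
    ... | tri≈ _ i≡j _ = i≡j
    ... | tri> _ _ j<i = ⊥-elim (at-distinct 2≤m j<i i≤m (sym eq))

    containsF9 : 2 ≤ m → ContainsF9 G
    containsF9 2≤m =
      m , 2≤m , at W ∘ toℕ , toℕ-injective ∘ at-injective 2≤m (bound _) (bound _) , adj≡f9adj
      where
      bound : (i : Fin (suc m)) → toℕ i ≤ m
      bound = toℕ≤pred[n]

      adj≡f9adj : ∀ i j → adj G (at W (toℕ i)) (at W (toℕ j)) ≡ f9adj m i j
      adj≡f9adj i j = ⇔→≡ (⇔-trans (mk⇔ (Adj⇒F9Edge (bound i) (bound j)) (F9Edge⇒Adj (bound i) (bound j)))
                                    (⇔-sym (f9adj≡true⇔F9Edge m i j)))

  module _ {u v : Fin n} (W : ℕWalk u v) {a b : ℕ} (a≤b : a ≤ b) (b≤L : b ≤ size W) where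

    private
      a+[b∸a]≡b : a + (b ∸ a) ≡ b
      a+[b∸a]≡b = m+[n∸m]≡n a≤b

      shift-≤ : ∀ {t} → t ≤ b ∸ a → a + t ≤ b
      shift-≤ t≤ = subst (_ ≤_) a+[b∸a]≡b (+-monoʳ-≤ a t≤)

      shift-< : ∀ {t} → t < b ∸ a → a + t < b
      shift-< t< = subst (_ <_) a+[b∸a]≡b (+-monoʳ-< a t<)

    segment : ℕWalk (at W a) (at W b)
    segment = record
      { size    = b ∸ a
      ; at      = at W ∘ (a +_)
      ; at-0    = cong (at W) (+-identityʳ a)
      ; at-size = cong (at W) a+[b∸a]≡b
      ; edge    = λ t t< → subst (Adj G (at W (a + t)) ∘ at W) (sym (+-suc a t))
                                 (edge W (a + t) (<-≤-trans (shift-< t<) b≤L))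
      }

    segment-chordless : Chordless W → Chordless segment
    segment-chordless chordless i j j≤ far =
      chordless (a + i) (a + j) (≤-trans (shift-≤ j≤) b≤L)
        (subst (_≤ a + j) (trans (+-suc a (suc i)) (cong suc (+-suc a i))) (+-monoʳ-≤ a far))

    segment-allInterior : (P : Fin n → Set) → (∀ k → a < k → k < b → P (at W k)) → AllInterior segment P
    segment-allInterior _ between t 0<t t< = between (a + t) (m<m+n a 0<t) (shift-< t<)

  loopless-vertex⇒containsF9 : ∀ {u v} (W : ℕWalk u v) → Chordless W → HasLoop G u → HasLoop G v
                             → ∀ x → x ≤ size W → NoLoop (at W x) → ContainsF9 G
  loopless-vertex⇒containsF9 W chordless loop-u loop-v x x≤L no-loop
    with gap loop? (loop-at-0 W loop-u) (size W) (loop-at-size W loop-v) x x≤L no-loop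
    where
    loop? : Decidable (HasLoop G ∘ at W)
    loop? k = adj G (at W k) (at W k) ≟ᵇ true
  ... | a , b , a+2≤b , b≤L , loop-a , loop-b , between =
    LoopedEnds.containsF9 (segment W a≤b b≤L) loop-a loop-b (segment-chordless W a≤b b≤L chordless)
      (segment-allInterior W a≤b b≤L NoLoop between) (m+n≤o⇒m≤o∸n 2 a+2≤b)
    where
    a≤b : a ≤ b
    a≤b = ≤-trans (m≤n+m a 2) a+2≤b

  Chord : ∀ {u v} → ℕWalk u v → Set
  Chord W = ∃[ i ] ∃[ j ] j ≤ size W × 2 + i ≤ j × Adj G (at W i) (at W j)

  chord? : ∀ {u v} (W : ℕWalk u v) → Dec (Chord W)
  chord? W = map′ fromUpTo toUpTo
    (anyUpTo? (λ j → anyUpTo? (λ i → (2 + i ≤? j) ×-dec (adj G (at W i) (at W j) ≟ᵇ true)) j) (suc (size W)))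
    where
    fromUpTo : (∃ λ j → j < suc (size W) × ∃ λ i → i < j × 2 + i ≤ j × Adj G (at W i) (at W j)) → Chord W
    fromUpTo (j , j<1+L , i , _ , far , ij) = i , j , s≤s⁻¹ j<1+L , far , ij
    toUpTo : Chord W → ∃ λ j → j < suc (size W) × ∃ λ i → i < j × 2 + i ≤ j × Adj G (at W i) (at W j)
    toUpTo (i , j , j≤L , far , ij) = j , s≤s j≤L , i , ≤-trans (n≤1+n _) far , far , ij

  -- Following the chord from i to j = suc i + d skips the d vertices strictly between them.
  module Splice {u v : Fin n} (W : ℕWalk u v) {i j : ℕ} (j≤L : j ≤ size W) (far : 2 + i ≤ j)
                (chord : Adj G (at W i) (at W j)) where

    private
      L d : ℕ
      L = size W
      d = j ∸ suc i

      1+i+d≡j : suc i + d ≡ j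
      1+i+d≡j = m+[n∸m]≡n (≤-trans (n≤1+n _) far)

      d≤L : d ≤ L
      d≤L = ≤-trans (m∸n≤m j (suc i)) j≤L

      i<L : i < L
      i<L = ≤-trans (≤-trans (n≤1+n _) far) j≤L

      i<L∸d : i < L ∸ d
      i<L∸d = m+n≤o⇒m≤o∸n (suc i) (subst (_≤ L) (sym 1+i+d≡j) j≤L)

      unskip-< : ∀ {k} → k < L ∸ d → k + d < L
      unskip-< {k} k< = subst (k + d <_) (m∸n+n≡m d≤L) (+-monoˡ-< d k<)

      spliced-edge : ∀ k → k < L ∸ d → Adj G (at W (skip i d k)) (at W (skip i d (suc k)))
      spliced-edge k k< with <-cmp k i
      ... | tri< k<i _ _ rewrite skip-≤ d (<⇒≤ k<i) | skip-≤ d k<i = edge W k (<-trans k<i i<L)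
      ... | tri≈ _ refl _ rewrite skip-≤ d (≤-refl {k}) | skip-> d (n<1+n k) | 1+i+d≡j = chord
      ... | tri> _ _ i<k rewrite skip-> d i<k | skip-> d (m<n⇒m<1+n i<k) = edge W (k + d) (unskip-< k<)

    spliced : ℕWalk u v
    spliced = record
      { size    = L ∸ d
      ; at      = at W ∘ skip i d
      ; at-0    = trans (cong (at W) (skip-≤ {i} d z≤n)) (at-0 W)
      ; at-size = trans (cong (at W) (trans (skip-> d i<L∸d) (m∸n+n≡m d≤L))) (at-size W)
      ; edge    = spliced-edge
      }

    spliced-shorter : size spliced < L
    spliced-shorter = ∸-monoʳ-< (m<n⇒0<n∸m far) d≤L

    spliced-allInterior : (P : Fin n → Set) → AllInterior W P → AllInterior spliced P
    spliced-allInterior _ interior k 0<k k< with k ≤? i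
    ... | yes k≤i = interior k 0<k (≤-<-trans k≤i i<L)
    ... | no  _   = interior (k + d) (≤-trans 0<k (m≤m+n k d)) (unskip-< k<)

  chordless-shortcut : ∀ {u v} (P : Fin n → Set) (W : ℕWalk u v) → AllInterior W P
                     → ∃[ W′ ] Chordless W′ × AllInterior W′ P
  chordless-shortcut P W = go W (<-wellFounded (size W))
    where
    go : ∀ {u v} (W : ℕWalk u v) → Acc _<_ (size W) → AllInterior W P
       → ∃[ W′ ] Chordless W′ × AllInterior W′ P
    go W (acc shorter) interior with chord? W
    ... | yes (i , j , j≤L , far , ij) =
      go (Splice.spliced W j≤L far ij) (shorter (Splice.spliced-shorter W j≤L far ij))
         (Splice.spliced-allInterior W j≤L far ij P interior)
    ... | no ¬chord = W , (λ i j j≤L far ij → ¬chord (i , j , j≤L , far , ij)) , interior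

  2≤size : ∀ {u v} → HasLoop G u → ¬ Adj G u v → (W : ℕWalk u v) → 2 ≤ size W
  2≤size loop-u ¬uv W with size W | at-size W | edge W
  ... | zero        | at-0≡v | _      = ⊥-elim (¬uv (subst₂ (Adj G) (at-0 W) at-0≡v (loop-at-0 W loop-u)))
  ... | suc zero    | at-1≡v | edge-0 = ⊥-elim (¬uv (subst₂ (Adj G) (at-0 W) at-1≡v (edge-0 0 (s≤s z≤n))))
  ... | suc (suc _) | _      | _      = s≤s (s≤s z≤n)

  loopless-interior⇒containsF9 : ∀ {u v} (W : ℕWalk u v) → HasLoop G u → HasLoop G v → ¬ Adj G u v
                               → AllInterior W NoLoop → ContainsF9 G
  loopless-interior⇒containsF9 W loop-u loop-v ¬uv loopless with chordless-shortcut NoLoop W loopless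
  ... | W′ , chordless , loopless′ =
    LoopedEnds.containsF9 W′ loop-u loop-v chordless loopless′ (2≤size loop-u ¬uv W′)

  module _ {u v : Fin n} (W : Walk G u v) where

    fromWalk : ℕWalk u v
    fromWalk = record
      { size    = len W
      ; at      = vtx W ∘ clamp (len W)
      ; at-0    = start W
      ; at-size = trans (cong (vtx W) (clamp-toℕ _ (toℕ-fromℕ _))) (end W)
      ; edge    = λ i i<L → subst₂ (Adj G)
          (cong (vtx W) (sym (clamp-toℕ _ (trans (toℕ-inject₁ _) (toℕ-fromℕ< i<L)))))
          (cong (vtx W) (sym (clamp-toℕ _ (cong suc (toℕ-fromℕ< i<L)))))
          (step W (fromℕ< i<L))
      }

    fromWalk-toℕ : (x : Fin (suc (len W))) → at fromWalk (toℕ x) ≡ vtx W x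
    fromWalk-toℕ x = cong (vtx W) (clamp-toℕ x refl)

    fromWalk-allInterior : (P : Fin n → Set) → (∀ x → Internal W x → P (vtx W x)) → AllInterior fromWalk P
    fromWalk-allInterior _ interior k 0<k k<L =
      interior (clamp (len W) k) (subst (0 <_) (sym k≡) 0<k , subst (_< len W) (sym k≡) k<L)
      where
      k≡ : toℕ (clamp (len W) k) ≡ k
      k≡ = toℕ-clamp (<⇒≤ k<L)

  inducedPath-chordless : ∀ {u v} (P : InducedPath G u v) → Chordless (fromWalk (walk P))
  inducedPath-chordless P i j j≤L far
    with clamp (len (walk P)) i | toℕ-clamp {len (walk P)} (≤-trans (m≤n+m i 2) (≤-trans far j≤L))
       | clamp (len (walk P)) j | toℕ-clamp {len (walk P)} j≤L
  ... | x | refl | y | refl with far-apart far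
  ...   | i≢j , i+1≢j , j+1≢i = chordless P x y i≢j i+1≢j j+1≢i

lemma9 : ∀ {n} (G : Graph n) (u v : Fin n) → HasLoop G u → HasLoop G v → ¬ Adj G u v
         → ((P : InducedPath G u v) → Σ _ (λ i → Internal (walk P) i × ¬ HasLoop G (vtx (walk P) i)) → ContainsF9 G)
           × ((W : Walk G u v) → (∀ i → Internal W i → ¬ HasLoop G (vtx W i)) → ContainsF9 G)
lemma9 G u v loop-u loop-v ¬uv = induced-path-case , walk-case
  where
  induced-path-case : (P : InducedPath G u v) → Σ _ (λ i → Internal (walk P) i × ¬ HasLoop G (vtx (walk P) i))
                    → ContainsF9 G
  induced-path-case P (x , _ , no-loop) =
    loopless-vertex⇒containsF9 G (fromWalk G (walk P)) (inducedPath-chordless G P) loop-u loop-v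
      (toℕ x) (toℕ≤pred[n] x) (subst (NoLoop G) (sym (fromWalk-toℕ G (walk P) x)) no-loop)

  walk-case : (W : Walk G u v) → (∀ i → Internal W i → ¬ HasLoop G (vtx W i)) → ContainsF9 G
  walk-case W loopless =
    loopless-interior⇒containsF9 G (fromWalk G W) loop-u loop-v ¬uv (fromWalk-allInterior G W (NoLoop G) loopless)
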